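{- In an $n$-vertex graph with feedback vertex set number $\phi$, the number of simple paths is at most \[\phi!\,2^\phi\left(\binom{n-\phi}{2}+(n-\phi)+1\right)^{\phi+1}.\]
   Context: A feedback vertex set of a graph is a vertex subset whose removal leaves a forest; the feedback vertex set number is the minimum size of a feedback vertex set. -}

module Defs where

open import Data.Nat using (ℕ; zero; suc; _+_; _*_; _∸_; _^_; _≤_; _!)
open import Data.Nat.Combinatorics using (_C_)
open import Data.Bool using (Bool; true; false)
open import Data.Fin using (Fin; toℕ)
open import Data.Fin.Subset using (Subset; _∈_; _∉_; ∣_∣)
import Data.Fin.Properties as FinP
open import Data.List using (List; []; _∷_; length; map; concatMap; allFin; filter; upTo)
open import Data.Nat.ListAction using (sum)
open import Data.List.Relation.Unary.Linked using (Linked; linked?)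
open import Data.List.Relation.Unary.All using (All)
open import Data.List.Relation.Unary.Unique.Propositional using (Unique)
import Data.List.Relation.Unary.Unique.DecPropositional as UD
open import Data.Maybe using (Maybe; just; nothing)
open import Data.Product using (_×_; Σ; ∃; _,_)
open import Data.Empty using (⊥)
open import Relation.Nullary using (Dec; yes; no; ¬_; _×-dec_)
open import Relation.Binary.PropositionalEquality using (_≡_; refl)
open import Data.Bool.Properties using () renaming (_≟_ to _≟B_)

record Graph (n : ℕ) : Set where
  field
    adj   : Fin n → Fin n → Bool
    sym   : ∀ i j → adj i j ≡ adj j i
    irrefl : ∀ i → adj i i ≡ false

open Graph public

Adj : ∀ {n} → Graph n → Fin n → Fin n → Set
Adj G i j = adj G i j ≡ true

Adj? : ∀ {n} (G : Graph n) i j → Dec (Adj G i j)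
Adj? G i j = adj G i j ≟B true

lastOr : ∀ {A : Set} → A → List A → A
lastOr d []       = d
lastOr d (x ∷ xs) = lastOr x xs

IsCycleAvoiding : ∀ {n} → Graph n → Subset n → List (Fin n) → Set
IsCycleAvoiding G S []       = ⊥
IsCycleAvoiding G S (v ∷ vs) =
  3 ≤ length (v ∷ vs) × Unique (v ∷ vs) × Linked (Adj G) (v ∷ vs)
  × Adj G (lastOr v vs) v × All (λ u → u ∉ S) (v ∷ vs)

IsFeedbackVertexSet : ∀ {n} → Graph n → Subset n → Set
IsFeedbackVertexSet G S = ∀ c → ¬ IsCycleAvoiding G S c

IsFVSNumber : ∀ {n} → Graph n → ℕ → Set
IsFVSNumber {n} G φ =
  Σ (Subset n) (λ S → IsFeedbackVertexSet G S × ∣ S ∣ ≡ φ)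
  × (∀ (S : Subset n) → IsFeedbackVertexSet G S → φ ≤ ∣ S ∣)

-- A path and its reverse are the same path,
-- so we count each path once via its canonical orientation: first vertex ≤
-- last vertex (in Fin order).
IsOrientedSimplePath : ∀ {n} → Graph n → List (Fin n) → Set
IsOrientedSimplePath G []       = ⊥
IsOrientedSimplePath G (v ∷ vs) =
  Unique (v ∷ vs) × Linked (Adj G) (v ∷ vs) × toℕ v ≤ toℕ (lastOr v vs)

isOrientedSimplePath? : ∀ {n} (G : Graph n) (p : List (Fin n)) →
                        Dec (IsOrientedSimplePath G p)
isOrientedSimplePath? G []       = no (λ ())
isOrientedSimplePath? G (v ∷ vs) =
  UD.unique? FinP._≟_ (v ∷ vs) ×-dec (linked? (Adj? G) (v ∷ vs)
    ×-dec (toℕ v Data.Nat.≤? toℕ (lastOr v vs)))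

listsOfLength : ∀ {n} → ℕ → List (List (Fin n))
listsOfLength zero    = [] ∷ []
listsOfLength {n} (suc k) =
  concatMap (λ i → map (i ∷_) (listsOfLength k)) (allFin n)

-- number of simple paths of G (a simple path has at most n vertices)
numSimplePaths : ∀ {n} → Graph n → ℕ
numSimplePaths {n} G =
  sum (map (λ k → length (filter (isOrientedSimplePath? G) (listsOfLength {n} k)))
           (upTo (suc n)))

module Submission where

-- Fix a feedback vertex set S with |S| = φ and let
-- m = n - φ be the number of vertices of the forest G - S.
--  * In a forest a path is determined by its two ends (forestPath-unique), so a
--    list `segments` of at most D = 1 + m² sequences contains every path of G - S,
--    the empty one included.
--  * A simple path, read in either direction, splits as σ₀ s₁ σ₁ … s_k σ_k with
--    forest paths σᵢ and distinct sᵢ ∈ S.  Hence it lies in the explicit list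
--    `candidates`, of length at most g D φ where g D 0 = D and
--    g D (k+1) = D + D (k+1) g D k.
--  * numSimplePaths counts each path in one orientation; adding the reversals of
--    all paths with two or more vertices gives distinct simple vertex sequences,
--    so 2 · numSimplePaths G ≤ g D φ + n.
--  * Arithmetic: g D φ ≤ φ! (D+1)^φ D and 2T = D + m + 1 for T = C(m,2) + m + 1
--    yield g D φ + n ≤ 2 φ! 2^φ T^(φ+1).

open import Defs hiding (sym)
open import Data.Nat using (ℕ; zero; suc; _+_; _*_; _∸_; _^_; _≤_; _<_; _<?_; _!; z≤n; s≤s; >-nonZero)
open import Data.Nat.Properties
  using ( ≤-reflexive; ≤-trans; ≤-<-trans; ≤-antisym; ≮⇒≥; <-irrefl; m≤m+n; m≤n+m; suc-injective
        ; +-identityʳ; +-assoc; +-suc; +-mono-≤; +-monoˡ-≤; +-monoʳ-≤; m∸n+n≡m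
        ; *-identityˡ; *-identityʳ; *-assoc; *-distribˡ-+; *-mono-≤; *-monoˡ-≤; *-monoʳ-≤; *-cancelˡ-≤
        ; ^-distribˡ-+-*; ^-monoˡ-≤; m^n>0; 1≤n!; module ≤-Reasoning )
open import Data.Nat.Combinatorics using (_C_; nC1≡n; nCk+nC[k+1]≡[n+1]C[k+1])
open import Data.Nat.Tactic.RingSolver using (solve-∀)
open import Data.Nat.ListAction using (sum)
open import Data.Bool using (true; false)
import Data.Vec.Base as Vec
open import Data.Fin as Fin using (Fin; toℕ)
open import Data.Fin.Properties using (_≟_; toℕ-injective)
open import Data.Fin.Subset using (Subset; ∁; ∣_∣) renaming (_∈_ to _∈ₛ_; _∉_ to _∉ₛ_)
open import Data.Fin.Subset.Properties using (x∉p⇒x∈∁p; ∣∁p∣≡n∸∣p∣; ∣p∣≤n) renaming (_∈?_ to _∈ₛ?_)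
open import Data.List
  using (List; []; _∷_; [_]; _++_; length; map; concatMap; filter; reverse; reverseAcc; allFin; upTo; head)
open import Data.List.Properties
  using (length-++; length-map; length-tabulate; ++-identityʳ; unfold-reverse; reverse-injective; ∷-injectiveʳ)
open import Data.List.Membership.Propositional using (_∈_; lose; find)
open import Data.List.Membership.Propositional.Properties
  using (∈-map⁺; ∈-map⁻; ∈-++⁺ˡ; ∈-++⁺ʳ; ∈-++⁻; ∈-concatMap⁺; ∈-concatMap⁻; ∈-∃++; ∈-filter⁻; ∈-upTo⁺; ∈-allFin)
import Data.List.Membership.DecPropositional as DecMembership
open import Data.List.Relation.Unary.Any using (here; there)
open import Data.List.Relation.Unary.Any.Properties using (reverse⁻)
open import Data.List.Relation.Unary.All as All using (All; []; _∷_; all?)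
open import Data.List.Relation.Unary.AllPairs using ([]; _∷_)
open import Data.List.Relation.Unary.Linked as Linked using (Linked; []; [-]; _∷_; linked?)
open import Data.List.Relation.Unary.Unique.Propositional using (Unique)
import Data.List.Relation.Unary.Unique.Propositional.Properties as Unique
import Data.List.Relation.Unary.Unique.DecPropositional as DecUnique
import Data.List.Relation.Binary.Permutation.Setoid as Permutation
import Data.List.Relation.Binary.Permutation.Setoid.Properties as PermutationProperties
open import Data.Maybe using (Maybe; just)
open import Data.Maybe.Properties using (just-injective)
open import Data.Product using (Σ; _×_; _,_; proj₁; proj₂; map₂)
open import Data.Sum using (_⊎_; inj₁; inj₂)
open import Data.Unit using (⊤; tt)
open import Data.Empty using (⊥; ⊥-elim)
open import Relation.Nullary using (Dec; yes; no; ¬_; ¬?; _×-dec_)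
open import Relation.Binary.Definitions using (Symmetric; DecidableEquality)
open import Relation.Binary.PropositionalEquality
  using (_≡_; _≢_; refl; sym; trans; cong; subst; setoid; module ≡-Reasoning)

module _ {A : Set} where

  select : List A → List (A × List A)
  select []       = []
  select (x ∷ xs) = (x , xs) ∷ map (map₂ (x ∷_)) (select xs)

  length-select : ∀ xs → length (select xs) ≡ length xs
  length-select []       = refl
  length-select (x ∷ xs) = cong suc (trans (length-map (map₂ (x ∷_)) (select xs)) (length-select xs))

  select-length : ∀ {y r} xs → (y , r) ∈ select xs → length xs ≡ suc (length r)
  select-length (x ∷ xs) (here refl) = refl
  select-length (x ∷ xs) (there p) with ∈-map⁻ (map₂ (x ∷_)) p
  ... | _ , q , refl = cong suc (select-length xs q)

  select-∈ : ∀ {v xs} → v ∈ xs →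
             Σ (List A) λ r → (v , r) ∈ select xs × (∀ {z} → z ∈ xs → z ≢ v → z ∈ r)
  select-∈ {xs = x ∷ xs} (here refl) = xs , here refl , λ where
    (here z≡v) z≢v → ⊥-elim (z≢v z≡v)
    (there z∈) _   → z∈
  select-∈ {xs = x ∷ xs} (there v∈) with select-∈ v∈
  ... | r , p , keep = x ∷ r , there (∈-map⁺ (map₂ (x ∷_)) p) , λ where
    (here z≡x) _   → here z≡x
    (there z∈) z≢v → there (keep z∈ z≢v)

  unique-length-≤ : ∀ {xs ys : List A} → Unique xs → (∀ {z} → z ∈ xs → z ∈ ys) →
                    length xs ≤ length ys
  unique-length-≤ {[]}     _            _    = z≤n
  unique-length-≤ {x ∷ xs} {ys} (x∉xs ∷ u) xs⊆ys with select-∈ (xs⊆ys (here refl))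
  ... | r , p , keep = subst (suc (length xs) ≤_) (sym (select-length ys p))
    (s≤s (unique-length-≤ u (λ z∈ → keep (xs⊆ys (there z∈)) λ { refl → All.lookup x∉xs z∈ refl })))

  pick : {P : A → Set} → (∀ x → Dec (P x)) → A → List A → A
  pick P? d []       = d
  pick P? d (y ∷ ys) with P? y
  ... | yes _ = y
  ... | no  _ = pick P? d ys

  pick-satisfies : {P : A → Set} (P? : ∀ x → Dec (P x)) (d : A) (xs : List A) {x : A} →
                   x ∈ xs → P x → P (pick P? d xs)
  pick-satisfies P? d (y ∷ ys) x∈ px with P? y
  ... | yes py = py
  pick-satisfies P? d (y ∷ ys) (here refl) px | no ¬py = ⊥-elim (¬py px)
  pick-satisfies P? d (y ∷ ys) (there x∈)  px | no _   = pick-satisfies P? d ys x∈ px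

  length-filter-split : {P : A → Set} (P? : ∀ x → Dec (P x)) (xs : List A) →
    length xs ≡ length (filter P? xs) + length (filter (λ x → ¬? (P? x)) xs)
  length-filter-split P? [] = refl
  length-filter-split P? (x ∷ xs) with P? x
  ... | yes _ = cong suc (length-filter-split P? xs)
  ... | no  _ = trans (cong suc (length-filter-split P? xs)) (sym (+-suc _ _))

module _ {A B : Set} (f : A → List B) where

  length-concatMap : ∀ xs → length (concatMap f xs) ≡ sum (map (λ x → length (f x)) xs)
  length-concatMap []       = refl
  length-concatMap (x ∷ xs) = trans (length-++ (f x)) (cong (length (f x) +_) (length-concatMap xs))

  length-concatMap-≤ : ∀ xs b → (∀ x → x ∈ xs → length (f x) ≤ b) →
                       length (concatMap f xs) ≤ length xs * b
  length-concatMap-≤ []       b _ = z≤n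
  length-concatMap-≤ (x ∷ xs) b h = begin
    length (f x ++ concatMap f xs)          ≡⟨ length-++ (f x) ⟩
    length (f x) + length (concatMap f xs)  ≤⟨ +-mono-≤ (h x (here refl))
                                                 (length-concatMap-≤ xs b (λ y y∈ → h y (there y∈))) ⟩
    b + length xs * b                       ∎
    where open ≤-Reasoning

  unique-concatMap : (key : B → Maybe A) → (∀ x b → b ∈ f x → key b ≡ just x) →
                     (∀ x → Unique (f x)) → ∀ {xs} → Unique xs → Unique (concatMap f xs)
  unique-concatMap key keyed uf {[]}     _          = []
  unique-concatMap key keyed uf {x ∷ xs} (x∉xs ∷ u) =
    Unique.++⁺ (uf x) (unique-concatMap key keyed uf u) λ (b∈fx , b∈rest) →
      let (y , y∈xs , b∈fy) = find (∈-concatMap⁻ f {xs = xs} b∈rest)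
      in All.lookup x∉xs y∈xs (just-injective (trans (sym (keyed x _ b∈fx)) (keyed y _ b∈fy)))

module _ {A : Set} where

  lastOr-∈ : ∀ (y : A) u → lastOr y u ∈ y ∷ u
  lastOr-∈ y []      = here refl
  lastOr-∈ y (x ∷ u) = there (lastOr-∈ x u)

  lastOr-++ : ∀ (d : A) l z t → lastOr d (l ++ z ∷ t) ≡ lastOr z t
  lastOr-++ d []      z t = refl
  lastOr-++ d (x ∷ l) z t = lastOr-++ x l z t

  reverse-head : ∀ (a : A) xs → Σ (List A) λ t → reverse (a ∷ xs) ≡ lastOr a xs ∷ t
  reverse-head a xs = go xs a []
    where
    go : ∀ xs a acc → Σ (List A) λ t → reverseAcc (a ∷ acc) xs ≡ lastOr a xs ∷ t
    go []       a acc = acc , refl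
    go (x ∷ xs) a acc = go xs x (a ∷ acc)

  lastOr-reverse : ∀ (d a : A) xs → lastOr d (reverse (a ∷ xs)) ≡ a
  lastOr-reverse d a xs = trans (cong (lastOr d) (unfold-reverse a xs)) (lastOr-++ d (reverse xs) a [])

  unique-reverse : ∀ {xs : List A} → Unique xs → Unique (reverse xs)
  unique-reverse {xs} = Unique-resp-↭ (↭-sym (↭-reverse xs))
    where open Permutation (setoid A) using (↭-sym)
          open PermutationProperties (setoid A) using (Unique-resp-↭; ↭-reverse)

  linked-reverse : ∀ {R : A → A → Set} → Symmetric R → ∀ {xs} → Linked R xs → Linked R (reverse xs)
  linked-reverse {R} sym-R {[]}     _  = []
  linked-reverse {R} sym-R {a ∷ xs} lx = go xs a [] [-] lx
    where
    go : ∀ xs a acc → Linked R (a ∷ acc) → Linked R (a ∷ xs) → Linked R (reverseAcc (a ∷ acc) xs)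
    go []       a acc la _          = la
    go (y ∷ ys) a acc la (Ray ∷ ly) = go ys y (a ∷ acc) (sym-R Ray ∷ la) ly

  linked-++ : ∀ {R : A → A → Set} x u z t → Linked R (x ∷ u) → Linked R (z ∷ t) →
              R (lastOr x u) z → Linked R ((x ∷ u) ++ z ∷ t)
  linked-++ x []      z t _          lzt r = r ∷ lzt
  linked-++ x (y ∷ u) z t (Rxy ∷ lu) lzt r = Rxy ∷ linked-++ y u z t lu lzt r

  unique-++ˡ : ∀ (l : List A) {r} → Unique (l ++ r) → Unique l
  unique-++ˡ []      _          = []
  unique-++ˡ (x ∷ l) (x∉ ∷ u) = All.tabulate (λ z∈ → All.lookup x∉ (∈-++⁺ˡ z∈)) ∷ unique-++ˡ l u

  unique-++ʳ : ∀ (l : List A) {r} → Unique (l ++ r) → Unique r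
  unique-++ʳ []      u       = u
  unique-++ʳ (x ∷ l) (_ ∷ u) = unique-++ʳ l u

  linked-++ˡ : ∀ {R : A → A → Set} (l : List A) {r} → Linked R (l ++ r) → Linked R l
  linked-++ˡ []          _          = []
  linked-++ˡ (x ∷ [])    _          = [-]
  linked-++ˡ (x ∷ y ∷ l) (Rxy ∷ lu) = Rxy ∷ linked-++ˡ (y ∷ l) lu

  linked-++ʳ : ∀ {R : A → A → Set} (l : List A) {r} → Linked R (l ++ r) → Linked R r
  linked-++ʳ []      lu = lu
  linked-++ʳ (x ∷ l) lu = linked-++ʳ l (Linked.tail lu)

  linked-without-repeats : ∀ {R : A → A → Set} {l} → Unique l → Linked (λ u v → R u v ⊎ u ≡ v) l →
                           Linked R l
  linked-without-repeats _          []             = []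
  linked-without-repeats _          [-]            = [-]
  linked-without-repeats (_ ∷ u)    (inj₁ r ∷ l)   = r ∷ linked-without-repeats u l
  linked-without-repeats (x∉ ∷ _)   (inj₂ x≡y ∷ _) = ⊥-elim (All.lookup x∉ (here refl) x≡y)

module _ {A : Set} (eq? : DecidableEquality A) where

  open DecMembership eq? using (_∈?_)

  -- Every walk contains a path with the same ends: cutting out the closed detours
  -- of an R-chain from x leaves a duplicate-free R-chain from x to the same end.
  walk-to-path : ∀ {R : A → A → Set} x w → Linked R (x ∷ w) →
    Σ (List A) λ r → Unique (x ∷ r) × Linked R (x ∷ r) × lastOr x r ≡ lastOr x w
                     × (∀ {z} → z ∈ r → z ∈ w)
  walk-to-path x []      _          = [] , [] ∷ [] , [-] , refl , λ ()
  walk-to-path {R} x (y ∷ w) (Rxy ∷ lw) with walk-to-path y w lw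
  ... | r , uyr , lyr , same-end , r⊆w with x ∈? (y ∷ r)
  ... | no x∉yr = y ∷ r
      , All.tabulate (λ z∈ x≡z → x∉yr (subst (_∈ y ∷ r) (sym x≡z) z∈)) ∷ uyr
      , Rxy ∷ lyr
      , same-end
      , λ { (here z≡y) → here z≡y ; (there z∈r) → there (r⊆w z∈r) }
  ... | yes x∈yr with ∈-∃++ x∈yr
  ... | pre , post , yr≡ = post
      , unique-++ʳ pre (subst Unique yr≡ uyr)
      , linked-++ʳ pre (subst (Linked R) yr≡ lyr)
      , trans (sym (lastOr-++ y pre x post)) (trans (cong (lastOr y) (sym yr≡)) same-end)
      , λ z∈ → yr⊆yw (subst (_ ∈_) (sym yr≡) (∈-++⁺ʳ pre (there z∈)))
    where
    yr⊆yw : ∀ {z} → z ∈ y ∷ r → z ∈ y ∷ w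
    yr⊆yw (here z≡y)  = here z≡y
    yr⊆yw (there z∈r) = there (r⊆w z∈r)

-- The recurrence g D 0 = D, g D (k+1) = D + D·(k+1)·g D k; it bounds the number
-- of path shapes through k vertices of the feedback set when the forest has at
-- most D (possibly empty) paths.
candidateBound : ℕ → ℕ → ℕ
candidateBound D zero    = D
candidateBound D (suc k) = D + D * (suc k * candidateBound D k)

candidateBound-≤ : ∀ D k → candidateBound D k ≤ k ! * suc D ^ k * D
candidateBound-≤ D zero    = ≤-reflexive (sym (+-identityʳ D))
candidateBound-≤ D (suc k) = begin
  D + D * (suc k * candidateBound D k) ≤⟨ +-monoʳ-≤ D (*-monoʳ-≤ D (*-monoʳ-≤ (suc k)
                                                                    (candidateBound-≤ D k))) ⟩
  D + D * (suc k * (a * b * D))        ≡⟨ regroup₁ D k a b ⟩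
  D + M * D * D                        ≤⟨ +-monoˡ-≤ (M * D * D) D≤M*D ⟩
  M * D + M * D * D                    ≡⟨ regroup₂ D k a b ⟩
  (suc k * a) * (suc D * b) * D        ∎
  where
  open ≤-Reasoning
  a b M : ℕ
  a = k !
  b = suc D ^ k
  M = suc k * a * b
  D≤M*D : D ≤ M * D
  D≤M*D = ≤-trans (≤-reflexive (sym (*-identityˡ D)))
            (*-monoˡ-≤ D (*-mono-≤ (*-mono-≤ (s≤s (z≤n {k})) (1≤n! k)) (m^n>0 (suc D) k)))
  regroup₁ : ∀ D k a b → D + D * (suc k * (a * b * D)) ≡ D + (suc k * a * b) * D * D
  regroup₁ = solve-∀
  regroup₂ : ∀ D k a b →
             (suc k * a * b) * D + (suc k * a * b) * D * D ≡ (suc k * a) * (suc D * b) * D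
  regroup₂ = solve-∀

*-^-distrib : ∀ a b k → (a * b) ^ k ≡ a ^ k * b ^ k
*-^-distrib a b zero    = refl
*-^-distrib a b (suc k) =
  trans (cong (a * b *_) (*-^-distrib a b k)) (interchange a b (a ^ k) (b ^ k))
  where
  interchange : ∀ a b x y → a * b * (x * y) ≡ a * x * (b * y)
  interchange = solve-∀

suc≤2^ : ∀ k → suc k ≤ 2 ^ k
suc≤2^ zero    = s≤s z≤n
suc≤2^ (suc k) =
  ≤-trans (+-mono-≤ (m^n>0 2 k) (suc≤2^ k)) (≤-reflexive (cong (2 ^ k +_) (sym (+-identityʳ (2 ^ k)))))

twice-choose-2 : ∀ m → 2 * (m C 2) + m ≡ m * m
twice-choose-2 zero    = refl
twice-choose-2 (suc m) = begin
  2 * (suc m C 2) + suc m         ≡⟨ cong (λ c → 2 * c + suc m) (sym (nCk+nC[k+1]≡[n+1]C[k+1] m 1)) ⟩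
  2 * (m C 1 + m C 2) + suc m     ≡⟨ cong (λ c → 2 * (c + m C 2) + suc m) (nC1≡n m) ⟩
  2 * (m + m C 2) + suc m         ≡⟨ regroup m (m C 2) ⟩
  (2 * (m C 2) + m) + (2 * m + 1) ≡⟨ cong (_+ (2 * m + 1)) (twice-choose-2 m) ⟩
  m * m + (2 * m + 1)             ≡⟨ square m ⟩
  suc m * suc m                   ∎
  where
  open ≡-Reasoning
  regroup : ∀ m c → 2 * (m + c) + suc m ≡ (2 * c + m) + (2 * m + 1)
  regroup = solve-∀
  square : ∀ m → m * m + (2 * m + 1) ≡ suc m * suc m
  square = solve-∀

-- For D = 1 + m² and T = C(m,2) + m + 1 we
-- have 2T = D + (m + 1); with X = φ! 2^φ T^φ the recurrence satisfies
-- g D φ ≤ X·D, the term m + φ is at most X·(m + 1), and X·2T is twice the bound.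
candidateBound-estimate : ∀ m φ →
  candidateBound (suc (m * m)) φ + (m + φ) ≤ 2 * (φ ! * 2 ^ φ * (m C 2 + m + 1) ^ (φ + 1))
candidateBound-estimate m φ = begin
  candidateBound D φ + (m + φ)    ≤⟨ +-mono-≤ g≤XD m+φ≤X[m+1] ⟩
  X * D + X * suc m               ≡⟨ sym (*-distribˡ-+ X D (suc m)) ⟩
  X * (D + suc m)                 ≡⟨ cong (X *_) (sym twice-T) ⟩
  X * (2 * T)                     ≡⟨ regroup (φ !) (2 ^ φ) (T ^ φ) T ⟩
  2 * (φ ! * 2 ^ φ * (T ^ φ * T)) ≡⟨ cong (λ t → 2 * (φ ! * 2 ^ φ * t)) (sym T^[φ+1]) ⟩
  2 * (φ ! * 2 ^ φ * T ^ (φ + 1)) ∎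
  where
  open ≤-Reasoning
  D T X : ℕ
  D = suc (m * m)
  T = m C 2 + m + 1
  X = φ ! * 2 ^ φ * T ^ φ

  twice-T : 2 * T ≡ D + suc m
  twice-T = begin-equality
    2 * (m C 2 + m + 1)       ≡⟨ spread (m C 2) m ⟩
    (2 * (m C 2) + m) + m + 2 ≡⟨ cong (λ s → s + m + 2) (twice-choose-2 m) ⟩
    m * m + m + 2             ≡⟨ collect (m * m) m ⟩
    D + suc m                 ∎
    where
    spread : ∀ c m → 2 * (c + m + 1) ≡ (2 * c + m) + m + 2
    spread = solve-∀
    collect : ∀ s m → s + m + 2 ≡ suc s + suc m
    collect = solve-∀

  T^[φ+1] : T ^ (φ + 1) ≡ T ^ φ * T
  T^[φ+1] = trans (^-distribˡ-+-* T φ 1) (cong (T ^ φ *_) (*-identityʳ T))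

  g≤XD : candidateBound D φ ≤ X * D
  g≤XD = begin
    candidateBound D φ         ≤⟨ candidateBound-≤ D φ ⟩
    φ ! * suc D ^ φ * D        ≤⟨ *-monoˡ-≤ D (*-monoʳ-≤ (φ !) (^-monoˡ-≤ φ D+1≤2T)) ⟩
    φ ! * (2 * T) ^ φ * D      ≡⟨ cong (λ p → φ ! * p * D) (*-^-distrib 2 T φ) ⟩
    φ ! * (2 ^ φ * T ^ φ) * D  ≡⟨ cong (_* D) (sym (*-assoc (φ !) (2 ^ φ) (T ^ φ))) ⟩
    X * D                      ∎
    where
    D+1≤2T : suc D ≤ 2 * T
    D+1≤2T = ≤-trans (m≤m+n (suc D) m) (≤-reflexive (sym (trans twice-T (+-suc D m))))

  -- X ≥ φ + 1, because φ! ≥ 1, 2^φ ≥ φ + 1 and T ≥ 1.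
  m+φ≤X[m+1] : m + φ ≤ X * suc m
  m+φ≤X[m+1] = begin
    m + φ               ≤⟨ m≤m+n (m + φ) (suc (φ * m)) ⟩
    m + φ + suc (φ * m) ≡⟨ expand m φ ⟩
    suc φ * suc m       ≤⟨ *-monoˡ-≤ (suc m) suc[φ]≤X ⟩
    X * suc m           ∎
    where
    suc[φ]≤X : suc φ ≤ X
    suc[φ]≤X = ≤-trans (≤-reflexive (sym (*-identityʳ (suc φ))))
                 (*-mono-≤ (≤-trans (≤-reflexive (sym (*-identityˡ (suc φ))))
                                    (*-mono-≤ (1≤n! φ) (suc≤2^ φ)))
                           (m^n>0 T {{>-nonZero (m≤n+m 1 (m C 2 + m))}} φ))
    expand : ∀ m φ → m + φ + suc (φ * m) ≡ suc φ * suc m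
    expand = solve-∀

  regroup : ∀ f p t T → f * p * t * (2 * T) ≡ 2 * (f * p * (t * T))
  regroup = solve-∀

listsOfLength-complete : ∀ {n} (q : List (Fin n)) → q ∈ listsOfLength (length q)
listsOfLength-complete []      = here refl
listsOfLength-complete (x ∷ q) = ∈-concatMap⁺ (λ i → map (i ∷_) (listsOfLength (length q)))
  (lose (∈-allFin x) (∈-map⁺ (x ∷_) (listsOfLength-complete q)))

listsOfLength-length : ∀ {n} k {q : List (Fin n)} → q ∈ listsOfLength k → length q ≡ k
listsOfLength-length zero    (here refl) = refl
listsOfLength-length {n} (suc k) q∈
  with find (∈-concatMap⁻ (λ i → map (i ∷_) (listsOfLength k)) {xs = allFin n} q∈)
... | i , _ , q∈i with ∈-map⁻ (i ∷_) q∈i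
... | q , q∈k , refl = cong suc (listsOfLength-length k q∈k)

listsOfLength-unique : ∀ {n} k → Unique (listsOfLength {n} k)
listsOfLength-unique zero        = [] ∷ []
listsOfLength-unique {n} (suc k) =
  unique-concatMap (λ i → map (i ∷_) (listsOfLength k)) head starts-with
    (λ i → Unique.map⁺ ∷-injectiveʳ (listsOfLength-unique k)) (Unique.allFin⁺ n)
  where
  starts-with : ∀ i q → q ∈ map (i ∷_) (listsOfLength k) → head q ≡ just i
  starts-with i q q∈ with ∈-map⁻ (i ∷_) q∈
  ... | _ , _ , refl = refl

adj-sym : ∀ {n} (G : Graph n) → Symmetric (Adj G)
adj-sym G {u} {v} u~v = trans (sym (Graph.sym G u v)) u~v

module Orientations {n : ℕ} (G : Graph n) where

  OSP? : ∀ p → Dec (IsOrientedSimplePath G p)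
  OSP? = isOrientedSimplePath? G

  orientedOfLength : ℕ → List (List (Fin n))
  orientedOfLength k = filter OSP? (listsOfLength k)

  orientedPaths : List (List (Fin n))
  orientedPaths = concatMap orientedOfLength (upTo (suc n))

  numSimplePaths≡ : numSimplePaths G ≡ length orientedPaths
  numSimplePaths≡ = sym (length-concatMap orientedOfLength (upTo (suc n)))

  orientedPaths-unique : Unique orientedPaths
  orientedPaths-unique =
    unique-concatMap orientedOfLength (λ q → just (length q))
      (λ k q q∈ → cong just (listsOfLength-length k (proj₁ (∈-filter⁻ OSP? q∈))))
      (λ k → Unique.filter⁺ OSP? (listsOfLength-unique k)) (Unique.upTo⁺ (suc n))

  orientedPaths-sound : ∀ {p} → p ∈ orientedPaths → IsOrientedSimplePath G p
  orientedPaths-sound p∈ with find (∈-concatMap⁻ orientedOfLength {xs = upTo (suc n)} p∈)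
  ... | k , _ , p∈k = proj₂ (∈-filter⁻ OSP? {xs = listsOfLength k} p∈k)

  oriented⇒simple : ∀ {p} → IsOrientedSimplePath G p → Unique p × Linked (Adj G) p
  oriented⇒simple {_ ∷ _} (u , l , _) = u , l

  Strict : List (Fin n) → Set
  Strict []       = ⊥
  Strict (v ∷ vs) = toℕ v < toℕ (lastOr v vs)

  strict? : ∀ p → Dec (Strict p)
  strict? []       = no λ ()
  strict? (v ∷ vs) = toℕ v <? toℕ (lastOr v vs)

  reverse-not-oriented : ∀ q → Strict q → ¬ IsOrientedSimplePath G (reverse q)
  reverse-not-oriented (w ∷ ws) w<last oriented
    with reverse (w ∷ ws) | reverse-head w ws | lastOr-reverse w w ws
  ... | _ | t , refl | last≡w = <-irrefl refl (≤-<-trans last≤w w<last)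
    where
    last≤w : toℕ (lastOr w ws) ≤ toℕ w
    last≤w = subst (λ u → toℕ (lastOr w ws) ≤ toℕ u) last≡w (proj₂ (proj₂ oriented))

  non-strict-is-vertex : ∀ {p} → IsOrientedSimplePath G p → ¬ Strict p → p ∈ map [_] (allFin n)
  non-strict-is-vertex {v ∷ []}     _                      _          = ∈-map⁺ [_] (∈-allFin v)
  non-strict-is-vertex {v ∷ y ∷ ys} (v∉ ∷ _ , _ , v≤last) not-strict =
    ⊥-elim (All.lookup v∉ (lastOr-∈ y ys) (toℕ-injective (≤-antisym v≤last (≮⇒≥ not-strict))))

  strictPaths : List (List (Fin n))
  strictPaths = filter strict? orientedPaths

  singleVertexPaths : List (List (Fin n))
  singleVertexPaths = filter (λ p → ¬? (strict? p)) orientedPaths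

  bothOrientations : List (List (Fin n))
  bothOrientations = orientedPaths ++ map reverse strictPaths

  bothOrientations-unique : Unique bothOrientations
  bothOrientations-unique = Unique.++⁺ orientedPaths-unique
    (Unique.map⁺ reverse-injective (Unique.filter⁺ strict? orientedPaths-unique)) disjoint
    where
    disjoint : ∀ {p} → ¬ (p ∈ orientedPaths × p ∈ map reverse strictPaths)
    disjoint (p∈ , p∈rev) with ∈-map⁻ reverse p∈rev
    ... | q , q∈ , refl =
      reverse-not-oriented q (proj₂ (∈-filter⁻ strict? {xs = orientedPaths} q∈)) (orientedPaths-sound p∈)

  bothOrientations-simple : ∀ {p} → p ∈ bothOrientations → Unique p × Linked (Adj G) p
  bothOrientations-simple p∈ with ∈-++⁻ orientedPaths p∈
  ... | inj₁ p∈o = oriented⇒simple (orientedPaths-sound p∈o)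
  ... | inj₂ p∈r with ∈-map⁻ reverse p∈r
  ... | q , q∈ , refl with ∈-filter⁻ strict? {xs = orientedPaths} q∈
  ... | q∈o , _ with oriented⇒simple (orientedPaths-sound q∈o)
  ... | uq , lq = unique-reverse uq , linked-reverse (adj-sym G) lq

  length-bothOrientations : length bothOrientations ≡ length orientedPaths + length strictPaths
  length-bothOrientations =
    trans (length-++ orientedPaths) (cong (length orientedPaths +_) (length-map reverse strictPaths))

  singleVertexPaths-length : length singleVertexPaths ≤ n
  singleVertexPaths-length = ≤-trans
    (unique-length-≤ (Unique.filter⁺ (λ p → ¬? (strict? p)) orientedPaths-unique) λ p∈ →
      let (p∈o , not-strict) = ∈-filter⁻ (λ p → ¬? (strict? p)) {xs = orientedPaths} p∈
      in non-strict-is-vertex (orientedPaths-sound p∈o) not-strict)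
    (≤-reflexive (trans (length-map [_] (allFin n)) (length-tabulate (λ i → i))))

  -- Each path with at least two vertices gives two simple vertex sequences, so a
  -- list containing every simple vertex sequence has at least 2·#paths − n entries.
  twice-numSimplePaths-≤ : (seqs : List (List (Fin n))) →
                           (∀ {p} → Unique p → Linked (Adj G) p → p ∈ seqs) →
                           2 * numSimplePaths G ≤ length seqs + n
  twice-numSimplePaths-≤ seqs complete = begin
    2 * numSimplePaths G ≡⟨ cong (2 *_) numSimplePaths≡ ⟩
    P + (P + 0)          ≡⟨ cong (P +_) (trans (+-identityʳ P) (length-filter-split strict? orientedPaths)) ⟩
    P + (P₂ + P₁)        ≡⟨ sym (+-assoc P P₂ P₁) ⟩
    P + P₂ + P₁          ≡⟨ cong (_+ P₁) (sym length-bothOrientations) ⟩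
    length bothOrientations + P₁
      ≤⟨ +-mono-≤ (unique-length-≤ bothOrientations-unique
                     (λ p∈ → let (u , l) = bothOrientations-simple p∈ in complete u l))
                   singleVertexPaths-length ⟩
    length seqs + n      ∎
    where
    open ≤-Reasoning
    P P₂ P₁ : ℕ
    P  = length orientedPaths
    P₂ = length strictPaths
    P₁ = length singleVertexPaths

elements : ∀ {n} → Subset n → List (Fin n)
elements Vec.[]          = []
elements (true Vec.∷ p)  = Fin.zero ∷ map Fin.suc (elements p)
elements (false Vec.∷ p) = map Fin.suc (elements p)

length-elements : ∀ {n} (p : Subset n) → length (elements p) ≡ ∣ p ∣
length-elements Vec.[]          = refl
length-elements (true Vec.∷ p)  = cong suc (trans (length-map Fin.suc (elements p)) (length-elements p))
length-elements (false Vec.∷ p) = trans (length-map Fin.suc (elements p)) (length-elements p)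

∈-elements : ∀ {n} {x : Fin n} {p : Subset n} → x ∈ₛ p → x ∈ elements p
∈-elements {p = true Vec.∷ p}  Vec.here          = here refl
∈-elements {p = true Vec.∷ p}  (Vec.there x∈p) = there (∈-map⁺ Fin.suc (∈-elements x∈p))
∈-elements {p = false Vec.∷ p} (Vec.there x∈p) = ∈-map⁺ Fin.suc (∈-elements x∈p)

module Forest {n : ℕ} (G : Graph n) (S : Subset n) (fvs : IsFeedbackVertexSet G S) where

  ForestPath : List (Fin n) → Set
  ForestPath q = Unique q × Linked (Adj G) q × All (_∉ₛ S) q

  forestPath-tail : ∀ {a q} → ForestPath (a ∷ q) → ForestPath q
  forestPath-tail (_ ∷ uq , lq , _ ∷ q∉S) = uq , Linked.tail lq , q∉S

  AdjOrEq : Fin n → Fin n → Set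
  AdjOrEq v w = Adj G v w ⊎ v ≡ w

  -- Two paths x ∷ u and y ∷ u' ending at the same vertex combine into a walk from
  -- x to y: along the first path, then back along the second.
  there-and-back : ∀ x u y u' → Linked (Adj G) (x ∷ u) → Linked (Adj G) (y ∷ u') →
                   lastOr x u ≡ lastOr y u' →
                   Σ (List (Fin n)) λ w → Linked AdjOrEq (x ∷ w) × lastOr x w ≡ y
                                          × (∀ {z} → z ∈ w → z ∈ u ⊎ z ∈ y ∷ u')
  there-and-back x u y u' lxu lyu' same-end with reverse-head y u'
  ... | t , rev≡ = u ++ b ∷ t , linked , ends-at-y , inside
    where
    b : Fin n
    b = lastOr y u'
    -- the turning point b is reached twice in a row
    linked : Linked AdjOrEq (x ∷ u ++ b ∷ t)
    linked = linked-++ x u b t (Linked.map inj₁ lxu)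
               (subst (Linked AdjOrEq) rev≡ (Linked.map inj₁ (linked-reverse (adj-sym G) lyu')))
               (inj₂ same-end)
    ends-at-y : lastOr x (u ++ b ∷ t) ≡ y
    ends-at-y = trans (lastOr-++ x u b t) (trans (cong (lastOr x) (sym rev≡)) (lastOr-reverse x y u'))
    inside : ∀ {z} → z ∈ u ++ b ∷ t → z ∈ u ⊎ z ∈ y ∷ u'
    inside z∈ with ∈-++⁻ u z∈
    ... | inj₁ z∈u  = inj₁ z∈u
    ... | inj₂ z∈bt = inj₂ (reverse⁻ (subst (_ ∈_) (sym rev≡) z∈bt))

  detour : ∀ x u y u' → Linked (Adj G) (x ∷ u) → Linked (Adj G) (y ∷ u') →
           lastOr x u ≡ lastOr y u' →
           Σ (List (Fin n)) λ r → Unique (x ∷ r) × Linked (Adj G) (x ∷ r) × lastOr x r ≡ y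
                                  × (∀ {z} → z ∈ r → z ∈ u ⊎ z ∈ y ∷ u')
  detour x u y u' lxu lyu' same-end with there-and-back x u y u' lxu lyu' same-end
  ... | w , lw , w-end , w-inside with walk-to-path _≟_ x w lw
  ... | r , uxr , lxr , r-end , r⊆w =
    r , uxr , linked-without-repeats uxr lxr , trans r-end w-end , λ z∈r → w-inside (r⊆w z∈r)

  -- Forest paths leaving a through different neighbours x ≢ y never end at the same
  -- vertex: a, the first path and the detour back to y would form a cycle of G - S.
  no-fork : ∀ a x u y u' → ForestPath (a ∷ x ∷ u) → ForestPath (a ∷ y ∷ u') →
            lastOr x u ≡ lastOr y u' → x ≢ y → ⊥
  no-fork a x u y u' (a∉xu ∷ _ , a~x ∷ lxu , a∉S ∷ xu∉S) (a∉yu' ∷ _ , a~y ∷ lyu' , _ ∷ yu'∉S)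
          same-end x≢y with detour x u y u' lxu lyu' same-end
  ... | r , uxr , lxr , ends-at-y , r-inside =
    fvs (a ∷ x ∷ r)
        (three-vertices r ends-at-y , unique , a~x ∷ lxr , closing , a∉S ∷ All.head xu∉S ∷ r∉S)
    where
    three-vertices : ∀ r → lastOr x r ≡ y → 3 ≤ length (a ∷ x ∷ r)
    three-vertices []      x≡y = ⊥-elim (x≢y x≡y)
    three-vertices (_ ∷ _) _   = s≤s (s≤s (s≤s z≤n))
    a∉r : ∀ {z} → z ∈ r → a ≢ z
    a∉r z∈r with r-inside z∈r
    ... | inj₁ z∈u   = All.lookup a∉xu (there z∈u)
    ... | inj₂ z∈yu' = All.lookup a∉yu' z∈yu'
    unique : Unique (a ∷ x ∷ r)
    unique = (All.head a∉xu ∷ All.tabulate a∉r) ∷ uxr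
    closing : Adj G (lastOr x r) a
    closing = subst (λ v → Adj G v a) (sym ends-at-y) (adj-sym G a~y)
    r∉S : All (_∉ₛ S) r
    r∉S = All.tabulate λ z∈r → case-inside (r-inside z∈r)
      where
      case-inside : ∀ {z} → z ∈ u ⊎ z ∈ y ∷ u' → z ∉ₛ S
      case-inside (inj₁ z∈u)   = All.lookup (All.tail xu∉S) z∈u
      case-inside (inj₂ z∈yu') = All.lookup yu'∉S z∈yu'

  forestPath-unique : ∀ a u u' → ForestPath (a ∷ u) → ForestPath (a ∷ u') →
                      lastOr a u ≡ lastOr a u' → u ≡ u'
  forestPath-unique a []      []       _              _               _        = refl
  forestPath-unique a []      (y ∷ u') _              (a∉yu' ∷ _ , _) a≡end    =
    ⊥-elim (All.lookup a∉yu' (lastOr-∈ y u') a≡end)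
  forestPath-unique a (x ∷ u) []       (a∉xu ∷ _ , _) _               end≡a    =
    ⊥-elim (All.lookup a∉xu (lastOr-∈ x u) (sym end≡a))
  forestPath-unique a (x ∷ u) (y ∷ u') p              q               same-end with x ≟ y
  ... | yes refl = cong (x ∷_) (forestPath-unique x u u' (forestPath-tail p) (forestPath-tail q) same-end)
  ... | no  x≢y  = ⊥-elim (no-fork a x u y u' p q same-end x≢y)

  -- The forest path from a to b (if any), found by search among all vertex sequences
  -- short enough to be duplicate-free.
  ForestPathBetween : Fin n → Fin n → List (Fin n) → Set
  ForestPathBetween a b []       = ⊥
  ForestPathBetween a b (v ∷ vs) = v ≡ a × lastOr v vs ≡ b × ForestPath (v ∷ vs)

  forestPathBetween? : ∀ a b q → Dec (ForestPathBetween a b q)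
  forestPathBetween? a b []       = no λ ()
  forestPathBetween? a b (v ∷ vs) =
    (v ≟ a) ×-dec (lastOr v vs ≟ b) ×-dec DecUnique.unique? _≟_ (v ∷ vs)
      ×-dec linked? (Adj? G) (v ∷ vs) ×-dec all? (λ w → ¬? (w ∈ₛ? S)) (v ∷ vs)

  shortSequences : List (List (Fin n))
  shortSequences = concatMap listsOfLength (upTo (suc n))

  forestPath : Fin n → Fin n → List (Fin n)
  forestPath a b = pick (forestPathBetween? a b) [] shortSequences

  forestPath-spec : ∀ a u → ForestPath (a ∷ u) → forestPath a (lastOr a u) ≡ a ∷ u
  forestPath-spec a u fp =
    found (pick-satisfies (forestPathBetween? a b) [] shortSequences listed (refl , refl , fp))
    where
    b : Fin n
    b = lastOr a u
    short : length (a ∷ u) ≤ n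
    short = ≤-trans (unique-length-≤ (proj₁ fp) (λ {z} _ → ∈-allFin z))
                    (≤-reflexive (length-tabulate (λ i → i)))
    listed : a ∷ u ∈ shortSequences
    listed = ∈-concatMap⁺ listsOfLength (lose (∈-upTo⁺ (s≤s short)) (listsOfLength-complete (a ∷ u)))
    found : ∀ {q} → ForestPathBetween a b q → q ≡ a ∷ u
    found {v ∷ vs} (refl , same-end , fq) = cong (a ∷_) (forestPath-unique a vs u fq fp same-end)

  m : ℕ
  m = n ∸ ∣ S ∣

  forestVertices : List (Fin n)
  forestVertices = elements (∁ S)

  forestVertices-length : length forestVertices ≡ m
  forestVertices-length = trans (length-elements (∁ S)) (∣∁p∣≡n∸∣p∣ S)

  -- With m forest vertices, G - S has at most 1 + m² paths, counting the empty one.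
  segmentBound : ℕ
  segmentBound = suc (length forestVertices * length forestVertices)

  segments : List (List (Fin n))
  segments = [] ∷ concatMap (λ a → map (forestPath a) forestVertices) forestVertices

  segments-length : length segments ≤ segmentBound
  segments-length = s≤s (length-concatMap-≤ (λ a → map (forestPath a) forestVertices) forestVertices _
                          (λ a _ → ≤-reflexive (length-map (forestPath a) forestVertices)))

  segments-complete : ∀ {σ} → ForestPath σ → σ ∈ segments
  segments-complete {[]}    _                  = here refl
  segments-complete {a ∷ u} fp@(_ , _ , au∉S) =
    there (∈-concatMap⁺ (λ a → map (forestPath a) forestVertices)
            (lose (forest-vertex (All.head au∉S)) found))
    where
    forest-vertex : ∀ {v} → v ∉ₛ S → v ∈ forestVertices
    forest-vertex v∉S = ∈-elements (x∉p⇒x∈∁p v∉S)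
    found : a ∷ u ∈ map (forestPath a) forestVertices
    found = subst (_∈ map (forestPath a) forestVertices) (forestPath-spec a u fp)
              (∈-map⁺ (forestPath a) (forest-vertex (All.lookup au∉S (lastOr-∈ a u))))

  extend : List (Fin n) → (List (Fin n) → List (List (Fin n))) → Fin n × List (Fin n) →
           List (List (Fin n))
  extend σ rec (s , A') = map (λ r → σ ++ s ∷ r) (rec A')

  -- candidates k A lists sequences σ₀ s₁ σ₁ … s_j σ_j with all σᵢ in segments and
  -- s₁, …, s_j distinct elements of A, where k = |A|.
  candidates : ℕ → List (Fin n) → List (List (Fin n))
  candidates zero    A = segments
  candidates (suc k) A =
    segments ++ concatMap (λ σ → concatMap (extend σ (candidates k)) (select A)) segments

  candidates-length : ∀ k A → length A ≡ k → length (candidates k A) ≤ candidateBound segmentBound k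
  candidates-length zero    A _     = segments-length
  candidates-length (suc k) A |A|≡k = begin
    length (segments ++ concatMap block segments)       ≡⟨ length-++ segments ⟩
    length segments + length (concatMap block segments) ≤⟨ +-mono-≤ segments-length
      (≤-trans (length-concatMap-≤ block segments _ block-length) (*-monoˡ-≤ _ segments-length)) ⟩
    D + D * (suc k * candidateBound D k)                ∎
    where
    open ≤-Reasoning
    D : ℕ
    D = segmentBound
    block : List (Fin n) → List (List (Fin n))
    block σ = concatMap (extend σ (candidates k)) (select A)
    extension-length : ∀ σ sA' → sA' ∈ select A →
                       length (extend σ (candidates k) sA') ≤ candidateBound D k
    extension-length σ (s , A') sA'∈ = ≤-trans (≤-reflexive (length-map _ (candidates k A')))
      (candidates-length k A' (suc-injective (trans (sym (select-length A sA'∈)) |A|≡k)))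
    block-length : ∀ σ → σ ∈ segments → length (block σ) ≤ suc k * candidateBound D k
    block-length σ _ =
      subst (λ l → length (block σ) ≤ l * candidateBound D k) (trans (length-select A) |A|≡k)
        (length-concatMap-≤ (extend σ (candidates k)) (select A) _ (extension-length σ))

  segments⊆candidates : ∀ k A {σ} → σ ∈ segments → σ ∈ candidates k A
  segments⊆candidates zero    A σ∈ = σ∈
  segments⊆candidates (suc k) A σ∈ = ∈-++⁺ˡ σ∈

  extension∈candidates : ∀ k A {σ s A' r} → σ ∈ segments → (s , A') ∈ select A →
                         r ∈ candidates k A' → σ ++ s ∷ r ∈ candidates (suc k) A
  extension∈candidates k A {σ} {s} σ∈ sA'∈ r∈ =
    ∈-++⁺ʳ segments (∈-concatMap⁺ (λ σ → concatMap (extend σ (candidates k)) (select A))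
      (lose σ∈ (∈-concatMap⁺ (extend σ (candidates k)) (lose sA'∈ (∈-map⁺ (λ r → σ ++ s ∷ r) r∈)))))

  SimplePathWithin : List (Fin n) → List (Fin n) → Set
  SimplePathWithin A p = Unique p × Linked (Adj G) p × (∀ {v} → v ∈ p → v ∈ₛ S → v ∈ A)

  StartsInS : List (Fin n) → Set
  StartsInS []      = ⊤
  StartsInS (s ∷ _) = s ∈ₛ S

  split-at-S : ∀ p → Σ (List (Fin n)) λ σ → Σ (List (Fin n)) λ rest →
               p ≡ σ ++ rest × All (_∉ₛ S) σ × StartsInS rest
  split-at-S []      = [] , [] , refl , [] , tt
  split-at-S (v ∷ p) with v ∈ₛ? S | split-at-S p
  ... | yes v∈S | _                               = [] , v ∷ p , refl , [] , v∈S
  ... | no  v∉S | σ , rest , refl , σ∉S , starts = v ∷ σ , rest , refl , v∉S ∷ σ∉S , starts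

  stretch∈segments : ∀ σ rest → Unique (σ ++ rest) → Linked (Adj G) (σ ++ rest) → All (_∉ₛ S) σ →
                     σ ∈ segments
  stretch∈segments σ rest u l σ∉S = segments-complete (unique-++ˡ σ u , linked-++ˡ σ l , σ∉S)

  candidates-complete : ∀ k A p → length A ≡ k → SimplePathWithin A p → p ∈ candidates k A
  through-S : ∀ k A σ s r → length A ≡ k → SimplePathWithin A (σ ++ s ∷ r) → All (_∉ₛ S) σ →
              s ∈ₛ S → σ ++ s ∷ r ∈ candidates k A

  candidates-complete k A p |A|≡k within@(u , l , _) with split-at-S p
  ... | σ , []    , refl , σ∉S , _   = subst (_∈ candidates k A) (sym (++-identityʳ σ))
                                         (segments⊆candidates k A (stretch∈segments σ [] u l σ∉S))
  ... | σ , s ∷ r , refl , σ∉S , s∈S = through-S k A σ s r |A|≡k within σ∉S s∈S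

  -- After the stretch σ comes s ∈ A; the rest r avoids s, so it is handled with A - s.
  through-S zero    (_ ∷ _) _ _ _ ()    _ _ _
  through-S zero    []      σ s r _     (_ , _ , inA) _ s∈S with inA (∈-++⁺ʳ σ (here refl)) s∈S
  ... | ()
  through-S (suc k) A σ s r |A|≡k (u , l , inA) σ∉S s∈S
    with select-∈ (inA (∈-++⁺ʳ σ (here refl)) s∈S)
  ... | A' , sA'∈ , keep =
    extension∈candidates k A (stretch∈segments σ (s ∷ r) u l σ∉S) sA'∈
      (candidates-complete k A' r (suc-injective (trans (sym (select-length A sA'∈)) |A|≡k)) within-r)
    where
    within-r : SimplePathWithin A' r
    within-r with unique-++ʳ σ u
    ... | s∉r ∷ ur = ur , Linked.tail (linked-++ʳ σ l) ,
      λ v∈r v∈S → keep (inA (∈-++⁺ʳ σ (there v∈r)) v∈S) (λ v≡s → All.lookup s∉r v∈r (sym v≡s))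

  numSimplePaths-bound : 2 * numSimplePaths G ≤ candidateBound (suc (m * m)) ∣ S ∣ + n
  numSimplePaths-bound = begin
    2 * numSimplePaths G
      ≤⟨ Orientations.twice-numSimplePaths-≤ G cands simple-is-candidate ⟩
    length cands + n
      ≤⟨ +-monoˡ-≤ n (candidates-length ∣ S ∣ (elements S) (length-elements S)) ⟩
    candidateBound segmentBound ∣ S ∣ + n
      ≡⟨ cong (λ k → candidateBound (suc (k * k)) ∣ S ∣ + n) forestVertices-length ⟩
    candidateBound (suc (m * m)) ∣ S ∣ + n ∎
    where
    open ≤-Reasoning
    cands : List (List (Fin n))
    cands = candidates ∣ S ∣ (elements S)
    simple-is-candidate : ∀ {p} → Unique p → Linked (Adj G) p → p ∈ cands
    simple-is-candidate u l =
      candidates-complete ∣ S ∣ (elements S) _ (length-elements S) (u , l , λ _ → ∈-elements)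

lemma7 : (n : ℕ) (G : Graph n) (φ : ℕ) → IsFVSNumber G φ →
         numSimplePaths G ≤ (φ !) * (2 ^ φ) * ((((n ∸ φ) C 2) + (n ∸ φ) + 1) ^ (φ + 1))
lemma7 n G _ ((S , fvs , refl) , _) = *-cancelˡ-≤ 2 (begin
  2 * numSimplePaths G                             ≤⟨ numSimplePaths-bound ⟩
  candidateBound (suc (m * m)) ∣ S ∣ + n           ≡⟨ cong (candidateBound (suc (m * m)) ∣ S ∣ +_) n≡m+|S| ⟩
  candidateBound (suc (m * m)) ∣ S ∣ + (m + ∣ S ∣) ≤⟨ candidateBound-estimate m ∣ S ∣ ⟩
  2 * (∣ S ∣ ! * 2 ^ ∣ S ∣ * (m C 2 + m + 1) ^ (∣ S ∣ + 1)) ∎)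
  where
  open ≤-Reasoning
  open Forest G S fvs using (m; numSimplePaths-bound)
  n≡m+|S| : n ≡ m + ∣ S ∣
  n≡m+|S| = sym (m∸n+n≡m (∣p∣≤n S))
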